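{- Let $y\in\mathrm{Tam}(B_n)$ and $x=\mathrm{rev}(y)$. If $1\le i\le 2n-1$ satisfies $x_i\ge n+1$ and $x_{i+1}\le n$, then $x_i>x_j$ for all $j<i$.
   Context: $B_n$ is the set of permutations $x=x_1\cdots x_{2n}$ of $\{1,\dots,2n\}$ with $x_i+x_{2n+1-i}=2n+1$ for all $i$. $x\in B_n$ contains a $312^*$ pattern if there are $i<j<k$ with $x_j<x_k<x_i$ and $x_k\ge n+1$; $\mathrm{Tam}(B_n)$ is the set of $312^*$-avoiding elements of $B_n$. $\mathrm{rev}(y)$ is obtained from $y$ by reversing each maximal descending run (maximal consecutive decreasing substring) of $y$. -}

module Defs where

open import Data.Nat using (ℕ; zero; suc; _+_; _*_; _∸_; _<_; _≤_; _<ᵇ_)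
open import Data.Bool using (if_then_else_)
open import Data.List using (List; []; _∷_; _++_; length; map; upTo; reverse)
open import Data.List.Relation.Binary.Permutation.Propositional using (_↭_)
open import Data.Product using (_×_; ∃-syntax)
open import Relation.Binary.PropositionalEquality using (_≡_)

-- Words are lists of natural numbers; positions are 0-indexed
-- (position p here is position p+1 in the paper), values are as in the paper.

-- value at (0-indexed) position p; 0 when out of range (never used out of range)
at : List ℕ → ℕ → ℕ
at []       _       = 0
at (a ∷ _)  zero    = a
at (_ ∷ xs) (suc p) = at xs p

IsPerm : ℕ → List ℕ → Set
IsPerm n x = x ↭ map suc (upTo (2 * n))

InB : ℕ → List ℕ → Set
InB n x = IsPerm n x ×
  (∀ p → p < 2 * n → at x p + at x (2 * n ∸ 1 ∸ p) ≡ suc (2 * n))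

Contains312* : ℕ → List ℕ → Set
Contains312* n x = ∃[ i ] ∃[ j ] ∃[ k ]
  (i < j × j < k × k < length x ×
   at x j < at x k × at x k < at x i × suc n ≤ at x k)

InTam : ℕ → List ℕ → Set
InTam n y = InB n y × (Contains312* n y → Data.Empty.⊥)
  where import Data.Empty

-- rev: reverse each maximal descending run.
-- revGo run ys : `run` is the current descending run stored reversed
-- (its last element first), ys the remaining input.
revGo : List ℕ → List ℕ → List ℕ
revGo run       []       = run
revGo []        (b ∷ ys) = revGo (b ∷ []) ys
revGo (a ∷ run) (b ∷ ys) =
  if b <ᵇ a then revGo (b ∷ a ∷ run) ys
            else (a ∷ run) ++ revGo (b ∷ []) ys

rev : List ℕ → List ℕ
rev y = revGo [] y

{-# OPTIONS --safe #-}
-- Reversing the descending runs of y turns each run into an ascending block of x = rev y, so a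
-- descent x_i > x_{i+1} of x ends a block: a = x_i is the first entry of a run of y, and the entry
-- p just before a in y (if any) satisfies p < a. An earlier x_j either lies in the same block, and
-- is then smaller than a, or occurs before a in y. In the latter case x_j > a would make x_j p a a
-- 312* pattern (a = x_i ≥ n+1), and x_j = a is excluded because y is a permutation.
module Submission where

open import Defs
open import Data.Nat using (ℕ; zero; suc; _+_; _*_; _<_; _≤_; z≤n; s≤s; _<ᵇ_)
open import Data.Nat.Properties
open import Data.Bool using (true; false; T)
open import Data.List using (List; []; _∷_; _++_; _∷ʳ_; [_]; length; upTo; reverse; take; drop)
open import Data.List.Properties
  using (∷-injective; ++-assoc; ʳ++-defn; ++-identityʳ; length-++; length-map; length-upTo; unfold-reverse; reverse-++)
open import Data.List.Membership.Propositional using (_∈_; _∉_)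
open import Data.List.Membership.Propositional.Properties using (∈-++⁺ˡ; ∈-++⁺ʳ; ∈-++⁻; ∈-∃++)
open import Data.List.Relation.Binary.Subset.Propositional using (_⊆_)
open import Data.List.Relation.Unary.Any using (here; there)
open import Data.List.Relation.Unary.Any.Properties using (reverse⁺)
open import Data.List.Relation.Unary.All as All using ()
open import Data.List.Relation.Unary.AllPairs using (_∷_)
open import Data.List.Relation.Unary.Linked as Linked using (Linked; []; [-]; _∷_)
open import Data.List.Relation.Unary.Linked.Properties using (Linked⇒AllPairs)
open import Data.List.Relation.Unary.Unique.Propositional using (Unique)
import Data.List.Relation.Unary.Unique.Propositional.Properties as Unique
open import Data.List.Relation.Binary.Permutation.Propositional using (↭-sym; ↭⇒↭ₛ)
open import Data.List.Relation.Binary.Permutation.Propositional.Properties using (↭-length)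
import Data.List.Relation.Binary.Permutation.Setoid.Properties as Perm
open import Data.Product using (∃; ∃₂; _×_; _,_)
open import Data.Sum using (_⊎_; inj₁; inj₂)
open import Data.Empty using (⊥-elim)
open import Relation.Nullary using (¬_)
open import Relation.Binary.Definitions using (tri<; tri≈; tri>)
open import Relation.Binary.PropositionalEquality hiding ([_])

IsPerm⇒Unique : ∀ n {x} → IsPerm n x → Unique x
IsPerm⇒Unique n x↭ =
  Perm.Unique-resp-↭ (setoid ℕ) (↭⇒↭ₛ (↭-sym x↭)) (Unique.map⁺ suc-injective (Unique.upTo⁺ (2 * n)))

IsPerm⇒length : ∀ n {x} → IsPerm n x → length x ≡ 2 * n
IsPerm⇒length n x↭ = trans (↭-length x↭) (trans (length-map suc (upTo (2 * n))) (length-upTo (2 * n)))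

Unique-++-∷⇒∉ : ∀ {A : Set} (P : List A) {a Q} → Unique (P ++ a ∷ Q) → a ∉ P
Unique-++-∷⇒∉ (_ ∷ P) (a∉ ∷ _) (here refl) = All.lookup a∉ (∈-++⁺ʳ P (here refl)) refl
Unique-++-∷⇒∉ (_ ∷ P) (_ ∷ u) (there a∈P) = Unique-++-∷⇒∉ P u a∈P

at-++ : ∀ (U R : List ℕ) m → at (U ++ R) (length U + m) ≡ at R m
at-++ []      R m = refl
at-++ (_ ∷ U) R m = at-++ U R m

length-++-< : ∀ {X : Set} (U R : List X) {m} → m < length R → length U + m < length (U ++ R)
length-++-< U R {m} m<R = subst (length U + m <_) (sym (length-++ U)) (+-monoʳ-< (length U) m<R)

at∈take : ∀ xs {i j} → j < i → j < length xs → at xs j ∈ take i xs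
at∈take (x ∷ xs) {suc i} {zero}  _         _         = here refl
at∈take (x ∷ xs) {suc i} {suc j} (s≤s j<i) (s≤s j<l) = there (at∈take xs j<i j<l)

take++at∷at∷drop : ∀ xs i → suc i < length xs →
  xs ≡ take i xs ++ at xs i ∷ at xs (suc i) ∷ drop (suc (suc i)) xs
take++at∷at∷drop (x ∷ y ∷ xs) zero    _         = refl
take++at∷at∷drop (x ∷ xs)     (suc i) (s≤s i<l) = cong (x ∷_) (take++at∷at∷drop xs i i<l)

++-adjacent : ∀ {X : Set} (L R A : List X) a b B → L ++ R ≡ A ++ a ∷ b ∷ B →
  (∃₂ λ A₁ B₁ → L ≡ A₁ ++ a ∷ b ∷ B₁)
  ⊎ (L ≡ A ∷ʳ a × R ≡ b ∷ B)
  ⊎ (∃ λ A′ → A ≡ L ++ A′ × R ≡ A′ ++ a ∷ b ∷ B)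
++-adjacent []          R A       a b B eq   = inj₂ (inj₂ (A , refl , eq))
++-adjacent (x ∷ [])    R []      a b B refl = inj₂ (inj₁ (refl , refl))
++-adjacent (x ∷ y ∷ L) R []      a b B refl = inj₁ ([] , L , refl)
++-adjacent (x ∷ L)     R (z ∷ A) a b B eq with refl , eq′ ← ∷-injective eq
  with ++-adjacent L R A a b B eq′
... | inj₁ (A₁ , B₁ , e)              = inj₁ (x ∷ A₁ , B₁ , cong (x ∷_) e)
... | inj₂ (inj₁ (e₁ , e₂))           = inj₂ (inj₁ (cong (x ∷_) e₁ , e₂))
... | inj₂ (inj₂ (A′ , e₁ , e₂))      = inj₂ (inj₂ (A′ , cong (x ∷_) e₁ , e₂))

Linked-++⁻ʳ : ∀ {A : Set} {R : A → A → Set} (L : List A) {M} → Linked R (L ++ M) → Linked R M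
Linked-++⁻ʳ []      l = l
Linked-++⁻ʳ (_ ∷ L) l = Linked-++⁻ʳ L (Linked.tail l)

ascending⇒¬descent : ∀ A {a b B} → Linked _<_ (A ++ a ∷ b ∷ B) → ¬ b < a
ascending⇒¬descent A l = <-asym (Linked.head (Linked-++⁻ʳ A l))

ascending⇒<last : ∀ A {a c} → Linked _<_ (A ∷ʳ a) → c ∈ A → c < a
ascending⇒<last (_ ∷ A) l (here refl) with Linked⇒AllPairs <-trans l
... | x<rest ∷ _ = All.lookup x<rest (∈-++⁺ʳ A (here refl))
ascending⇒<last (_ ∷ A) l (there c∈A) = ascending⇒<last A (Linked.tail l) c∈A

data LastAtMost (a : ℕ) : List ℕ → Set where
  []   : LastAtMost a []
  snoc : ∀ P {p} → p ≤ a → LastAtMost a (P ∷ʳ p)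

record RunHead (y : List ℕ) (a : ℕ) (A : List ℕ) : Set where
  constructor runHead
  field
    before after : List ℕ
    split        : y ≡ before ++ a ∷ after
    ascentBefore : LastAtMost a before
    covers       : ∀ {c} → c ∈ A → c ∈ before ⊎ c < a

RunHead-prepend : ∀ {L L′ p M y ys a A} → L ≡ L′ ∷ʳ p → p ≤ y → M ⊆ L →
  RunHead (y ∷ ys) a A → RunHead (L ++ y ∷ ys) a (M ++ A)
RunHead-prepend {L} {L′} {p} {M} {a = a} L≡ p≤y M⊆L (runHead P Q eq asc cov) =
  runHead (L ++ P) Q (trans (cong (L ++_) eq) (sym (++-assoc L P (a ∷ Q)))) (ascent p≤y asc eq) cov′
  where
  ascent : ∀ {y ys} → p ≤ y → LastAtMost a P → y ∷ ys ≡ P ++ a ∷ Q → LastAtMost a (L ++ P)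
  ascent p≤a []            refl = subst (LastAtMost a) (trans (sym L≡) (sym (++-identityʳ L))) (snoc L′ p≤a)
  ascent _   (snoc P′ q≤a) _    = subst (LastAtMost a) (++-assoc L P′ [ _ ]) (snoc (L ++ P′) q≤a)
  cov′ : ∀ {c} → c ∈ M ++ _ → c ∈ L ++ P ⊎ c < a
  cov′ c∈ with ∈-++⁻ M c∈
  ... | inj₁ c∈M = inj₁ (∈-++⁺ˡ (M⊆L c∈M))
  ... | inj₂ c∈A with cov c∈A
  ...   | inj₁ c∈P = inj₁ (∈-++⁺ʳ L c∈P)
  ...   | inj₂ c<a = inj₂ c<a

RunHead-revGo : ∀ r ys → Linked _<_ r → ∀ A {a b B} → revGo r ys ≡ A ++ a ∷ b ∷ B → b < a →
  RunHead (reverse r ++ ys) a A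
RunHead-revGo r [] r↗ A eq b<a = ⊥-elim (ascending⇒¬descent A (subst (Linked _<_) eq r↗) b<a)
RunHead-revGo [] (y ∷ ys) _ A eq b<a = RunHead-revGo [ y ] ys [-] A eq b<a
RunHead-revGo (x ∷ run) (y ∷ ys) r↗ A {a} eq b<a with y <ᵇ x in y<ᵇx
... | true = subst (λ z → RunHead z a A) (trans (sym (ʳ++-defn (y ∷ x ∷ run))) (ʳ++-defn (x ∷ run)))
               (RunHead-revGo (y ∷ x ∷ run) ys (<ᵇ⇒< y x (subst T (sym y<ᵇx) _) ∷ r↗) A eq b<a)
... | false with ++-adjacent (x ∷ run) (revGo [ y ] ys) A _ _ _ eq
...   | inj₁ (A₁ , B₁ , e) = ⊥-elim (ascending⇒¬descent A₁ (subst (Linked _<_) e r↗) b<a)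
...   | inj₂ (inj₁ (e , _)) = runHead [] (reverse A ++ y ∷ ys) split [] λ c∈A →
          inj₂ (ascending⇒<last A (subst (Linked _<_) e r↗) c∈A)
  where
  split : reverse (x ∷ run) ++ y ∷ ys ≡ a ∷ reverse A ++ y ∷ ys
  split = trans (cong (λ L → reverse L ++ y ∷ ys) e) (cong (_++ y ∷ ys) (reverse-++ A [ a ]))
...   | inj₂ (inj₂ (A′ , refl , e)) =
          RunHead-prepend (unfold-reverse x run) x≤y reverse⁺ (RunHead-revGo [ y ] ys [-] A′ e b<a)
  where
  x≤y : x ≤ y
  x≤y = ≮⇒≥ λ y<x → subst T y<ᵇx (<⇒<ᵇ y<x)

RunHead-rev : ∀ y A {a b B} → rev y ≡ A ++ a ∷ b ∷ B → b < a → RunHead y a A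
RunHead-rev y A = RunHead-revGo [] y [] A

length-revGo : ∀ r ys → length (revGo r ys) ≡ length r + length ys
length-revGo r         []       = sym (+-identityʳ (length r))
length-revGo []        (y ∷ ys) = length-revGo [ y ] ys
length-revGo (x ∷ run) (y ∷ ys) with y <ᵇ x
... | true  = trans (length-revGo (y ∷ x ∷ run) ys) (sym (+-suc (length (x ∷ run)) (length ys)))
... | false = trans (length-++ (x ∷ run)) (cong (length (x ∷ run) +_) (length-revGo [ y ] ys))

Contains312*-witness : ∀ n U c V p a Q → p < a → a < c → suc n ≤ a →
  Contains312* n (U ++ c ∷ V ++ p ∷ a ∷ Q)
Contains312*-witness n U c V p a Q p<a a<c n<a =
  length U + 0 , length U + suc (length V + 0) , length U + suc (length V + 1) ,
  +-monoʳ-< (length U) (s≤s z≤n) ,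
  +-monoʳ-< (length U) (s≤s (+-monoʳ-< (length V) (s≤s z≤n))) ,
  length-++-< U (c ∷ _) (s≤s (length-++-< V (p ∷ a ∷ Q) (s≤s (s≤s z≤n)))) ,
  subst₂ _<_ (sym at-p) (sym at-a) p<a ,
  subst₂ _<_ (sym at-a) (sym (at-++ U _ 0)) a<c ,
  subst (suc n ≤_) (sym at-a) n<a
  where
  at-p : at (U ++ c ∷ V ++ p ∷ a ∷ Q) (length U + suc (length V + 0)) ≡ p
  at-p = trans (at-++ U _ _) (at-++ V (p ∷ a ∷ Q) 0)
  at-a : at (U ++ c ∷ V ++ p ∷ a ∷ Q) (length U + suc (length V + 1)) ≡ a
  at-a = trans (at-++ U _ _) (at-++ V (p ∷ a ∷ Q) 1)

avoids312*⇒¬larger-before : ∀ {n P a Q c} → ¬ Contains312* n (P ++ a ∷ Q) → Unique (P ++ a ∷ Q) →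
  suc n ≤ a → LastAtMost a P → c ∈ P → ¬ a < c
avoids312*⇒¬larger-before {n} {a = a} {Q} avoids u n<a (snoc P′ {p} p≤a) c∈P a<c
  with ∈-++⁻ P′ c∈P
... | inj₂ (here refl) = <⇒≱ a<c p≤a
... | inj₁ c∈P′ with ∈-∃++ c∈P′
...   | U , V , refl = avoids (subst (Contains312* n) (sym reassoc)
          (Contains312*-witness n U _ V p a Q p<a a<c n<a))
  where
  reassoc : ((U ++ _ ∷ V) ∷ʳ p) ++ a ∷ Q ≡ U ++ _ ∷ V ++ p ∷ a ∷ Q
  reassoc = trans (++-assoc (U ++ _ ∷ V) [ p ] (a ∷ Q)) (++-assoc U (_ ∷ V) (p ∷ a ∷ Q))
  p<a : p < a
  p<a = ≤∧≢⇒< p≤a λ p≡a → Unique-++-∷⇒∉ ((U ++ _ ∷ V) ∷ʳ p) u (∈-++⁺ʳ (U ++ _ ∷ V) (here (sym p≡a)))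

RunHead⇒< : ∀ {n y a A} → ¬ Contains312* n y → Unique y → suc n ≤ a → RunHead y a A →
  ∀ {c} → c ∈ A → c < a
RunHead⇒< {a = a} avoids u n<a (runHead P Q refl ascent covers) {c} c∈A with covers c∈A
... | inj₂ c<a = c<a
... | inj₁ c∈P with <-cmp c a
...   | tri< c<a _ _ = c<a
...   | tri≈ _ refl _ = ⊥-elim (Unique-++-∷⇒∉ P u c∈P)
...   | tri> _ _ a<c = ⊥-elim (avoids312*⇒¬larger-before avoids u n<a ascent c∈P a<c)

mainTheorem14 : (n : ℕ) (y : List ℕ) → InTam n y →
    (i : ℕ) → suc i < 2 * n →
    suc n ≤ at (rev y) i → at (rev y) (suc i) ≤ n →
    (j : ℕ) → j < i → at (rev y) j < at (rev y) i
mainTheorem14 n y ((y↭ , _) , avoids) i i+1<2n n<xᵢ xᵢ₊₁≤n j j<i =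
  RunHead⇒< avoids (IsPerm⇒Unique n y↭) n<xᵢ
    (RunHead-rev y (take i x) (take++at∷at∷drop x i i+1<∣x∣) (≤-<-trans xᵢ₊₁≤n n<xᵢ))
    (at∈take x j<i (<-trans j<i (<-trans (n<1+n i) i+1<∣x∣)))
  where
  x : List ℕ
  x = rev y
  i+1<∣x∣ : suc i < length x
  i+1<∣x∣ = subst (suc i <_) (sym (trans (length-revGo [] y) (IsPerm⇒length n y↭))) i+1<2n
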